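{- Let $\eta:A^*\to A^*$ be a substitution and $u\in\mathrm{Per}(\eta)$ be a two-sided periodic point with growing seed. Let $p\geq1$ be the period of $u$. Let $n\in\mathbb{Z}\setminus\{ -1,0\}$ be an integer. If $q\in\mathbb{Z}$ is the $u$-quotient and $r\in\mathbb{N}$ is the $u$-remainder of $n$, then \[ u_n = \eta^p(u_q)[r] \quad\text{and}\quad \mathrm{rep}_{u}(n) = \mathrm{rep}_{u}(q)\odot \mathrm{tail}_{\eta,p,u_q}(r). \]
   Context: A substitution is a morphism $\eta$ of $A^*$ with $\eta(a)\neq\varepsilon$ for all letters and some growing letter ($|\eta^k(a)|\to\infty$). A two-sided word $u\in A^{\mathbb{Z}}$ is a periodic point of period $p$ if $\eta^p(u)=u$ ($p$ minimal); its seed is $u_{ -1}|u_0$, and the seed is growing if both letters are growing. $w[i]$ denotes the $i$-th letter of $w$ (indexing from $0$). Let $\mathcal{D}=\{\mathtt{0},\dots,\max_{c\in A}|\eta(c)|-1\}$ (an alphabet of integers) and $\odot$ the concatenation of words in $\mathcal{D}^*$. A sequence $(m_i,a_i)_{i=0,\dots,k-1}$ in $A^*\times A$ is admissible if $m_{i-1}a_{i-1}$ is a prefix of $\eta(a_i)$ for all $1\le i\le k-1$, and $x$-admissible if moreover $m_{k-1}a_{k-1}$ is a prefix of $\eta(x)$. For $x\in A$ and $0\le r<|\eta^p(x)|$, $\mathrm{tail}_{\eta,p,x}(r)=|m_{p-1}|\odot\cdots\odot|m_0|\in\mathcal{D}^p$, where $(m_i,a_i)_{i=0,\dots,p-1}$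 is the unique $x$-admissible sequence with $r=\sum_{j=0}^{p-1}|\eta^j(m_j)|$ (equivalently, the length-$r$ prefix of $\eta^p(x)$ equals $\eta^{p-1}(m_{p-1})\cdots\eta^0(m_0)$). For $n\geq1$ there is a unique $k$ divisible by $p$ and a unique $u_0$-admissible sequence $(m_i,a_i)_{i=0,\dots,k-1}$ with $m_{k-1}\cdots m_{k-p}\neq\varepsilon$ and $u_0u_1\cdots u_{n-1}=\eta^{k-1}(m_{k-1})\cdots\eta^0(m_0)$. For $n\le -2$ there is a unique $k$ divisible by $p$ and a unique $u_{ -1}$-admissible sequence $(m_i,a_i)_{i=0,\dots,k-1}$ with $\eta^{p-1}(m_{k-1})\cdots\eta^0(m_{k-p})a_{k-p}\neq\eta^p(u_{ -1})$ and $u_{ -|\eta^k(u_{ -1})|}\cdots u_{n-1}=\eta^{k-1}(m_{k-1})\cdots\eta^0(m_0)$. Using these, $\mathrm{rep}_u(n)=\mathtt{0}\odot|m_{k-1}|\odot\cdots\odot|m_0|$ if $n\ge1$, $\mathrm{rep}_u(0)=\mathtt{0}$, $\mathrm{rep}_u(-1)=\mathtt{1}$, and $\mathrm{rep}_u(n)=\mathtt{1}\odot|m_{k-1}|\odot\cdots\odot|m_0|$ if $n\le-2$. The $u$-quotient of $n\in\mathbb{Z}\setminus\{ -1,0\}$ is $q=|\eta^{k-p-1}(m_{k-1})\cdots\eta^0(m_p)|$ if $n\ge1$, and $q=|\eta^{k-p-1}(m_{k-1})\cdots\eta^0(m_p)|-|\eta^{k-p}(u_{ -1})|$ if $n\le-2$;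 the $u$-remainder is $r=|\eta^{p-1}(m_{p-1})\cdots\eta^0(m_0)|$, with $k$ and $(m_i,a_i)$ the sequence associated with $n$ just described. -}

module Defs where

open import Data.Nat as ℕ using (ℕ; zero; suc; _≤_; _<_; _*_; _∸_)
open import Data.Integer as ℤ using (ℤ; +_)
open import Data.Fin using (Fin)
open import Data.List using (List; []; _∷_; _++_; map; concat; concatMap; length; upTo; take; drop; [_]; _∷ʳ_)
open import Data.Product using (Σ; ∃; _×_; _,_; proj₁; proj₂)
open import Data.Sum using (_⊎_)
open import Data.Unit using (⊤)
open import Data.Maybe using (Maybe; just; nothing)
open import Relation.Binary.PropositionalEquality using (_≡_; _≢_)
open import Relation.Nullary using (¬_)

pow : {A : Set} → (A → List A) → ℕ → List A → List A
pow η zero    w = w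
pow η (suc k) w = concatMap η (pow η k w)

lookupM : {A : Set} → List A → ℕ → Maybe A
lookupM []       _       = nothing
lookupM (x ∷ xs) zero    = just x
lookupM (x ∷ xs) (suc i) = lookupM xs i

Prefix : {A : Set} → List A → List A → Set
Prefix xs ys = ∃ λ zs → xs ++ zs ≡ ys

Growing : {A : Set} → (A → List A) → A → Set
Growing η a = ∀ N → ∃ λ K → ∀ k → K ≤ k → N ≤ length (pow η k [ a ])

IsSubstitution : {A : Set} → (A → List A) → Set
IsSubstitution η = (∀ a → η a ≢ []) × ∃ λ a → Growing η a

segment : {A : Set} → (ℤ → A) → ℤ → ℕ → List A
segment u start len = map (λ i → u (start ℤ.+ + i)) (upTo len)

-- v = η^k(u) for two-sided words: η^k(u_0 ... u_{N-1}) is placed starting at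
-- position 0, and η^k(u_{-N} ... u_{-1}) is placed ending at position -1.
IsImage : {A : Set} → (A → List A) → ℕ → (ℤ → A) → (ℤ → A) → Set
IsImage η k u v =
  (∀ N i a → lookupM (pow η k (segment u (+ 0) N)) i ≡ just a → v (+ i) ≡ a) ×
  (∀ N i a → lookupM (pow η k (segment u (ℤ.- (+ N)) N)) i ≡ just a →
     v (ℤ.- (+ length (pow η k (segment u (ℤ.- (+ N)) N))) ℤ.+ + i) ≡ a)

IsPeriodicPoint : {A : Set} → (A → List A) → (ℤ → A) → ℕ → Set
IsPeriodicPoint η u p =
  1 ≤ p × IsImage η p u u × (∀ p′ → 1 ≤ p′ → p′ < p → ¬ IsImage η p′ u u)

GrowingSeed : {A : Set} → (A → List A) → (ℤ → A) → Set
GrowingSeed η u = Growing η (u (ℤ.- (+ 1))) × Growing η (u (+ 0))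

-- Sequences (m_i, a_i)_{i=0..k-1}, stored in REVERSED order:
-- the list is (m_{k-1},a_{k-1}) ∷ ... ∷ (m_0,a_0).

Seq : Set → Set
Seq A = List (List A × A)

Adm : {A : Set} → (A → List A) → A → Seq A → Set
Adm η x []             = ⊤
Adm η x ((m , a) ∷ rest) = Prefix (m ∷ʳ a) (η x) × Adm η a rest

expand : {A : Set} → (A → List A) → Seq A → List A
expand η []               = []
expand η ((m , a) ∷ rest) = pow η (length rest) m ++ expand η rest

digits : {A : Set} → Seq A → List ℕ
digits = map (λ e → length (proj₁ e))

lastLetter : {A : Set} → Seq A → List A
lastLetter []              = []
lastLetter ((m , a) ∷ [])  = [ a ]
lastLetter (_ ∷ e ∷ rest)  = lastLetter (e ∷ rest)

PosData : {A : Set} → (A → List A) → (ℤ → A) → ℕ → ℤ → Seq A → Set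
PosData η u p n rev =
  ℤ.+ 1 ℤ.≤ n ×
  (∃ λ j → length rev ≡ suc j * p) ×
  Adm η (u (+ 0)) rev ×
  concat (map proj₁ (take p rev)) ≢ [] ×
  n ≡ + length (expand η rev) ×
  segment u (+ 0) (length (expand η rev)) ≡ expand η rev

NegData : {A : Set} → (A → List A) → (ℤ → A) → ℕ → ℤ → Seq A → Set
NegData η u p n rev =
  n ℤ.≤ ℤ.- (+ 2) ×
  (∃ λ j → length rev ≡ suc j * p) ×
  Adm η (u (ℤ.- (+ 1))) rev ×
  expand η (take p rev) ++ lastLetter (take p rev) ≢ pow η p [ u (ℤ.- (+ 1)) ] ×
  n ≡ ℤ.- (+ length (pow η (length rev) [ u (ℤ.- (+ 1)) ])) ℤ.+ + length (expand η rev) ×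
  segment u (ℤ.- (+ length (pow η (length rev) [ u (ℤ.- (+ 1)) ]))) (length (expand η rev))
    ≡ expand η rev

data IsRep {A : Set} (η : A → List A) (u : ℤ → A) (p : ℕ) : ℤ → List ℕ → Set where
  rep0   : IsRep η u p (+ 0) (0 ∷ [])
  rep-1  : IsRep η u p (ℤ.- (+ 1)) (1 ∷ [])
  repPos : ∀ n rev → PosData η u p n rev → IsRep η u p n (0 ∷ digits rev)
  repNeg : ∀ n rev → NegData η u p n rev → IsRep η u p n (1 ∷ digits rev)

IsTail : {A : Set} → (A → List A) → ℕ → A → ℕ → List ℕ → Set
IsTail η p x r t =
  r < length (pow η p [ x ]) ×
  ∃ λ rev → length rev ≡ p × Adm η x rev × length (expand η rev) ≡ r × t ≡ digits rev

IsQuotRem : {A : Set} → (A → List A) → (ℤ → A) → ℕ → ℤ → ℤ → ℕ → Set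
IsQuotRem η u p n q r = ∃ λ rev →
  (PosData η u p n rev ×
     q ≡ + length (expand η (take (length rev ∸ p) rev)) ×
     r ≡ length (expand η (drop (length rev ∸ p) rev)))
  ⊎
  (NegData η u p n rev ×
     q ≡ + length (expand η (take (length rev ∸ p) rev))
         ℤ.- + length (pow η (length rev ∸ p) [ u (ℤ.- (+ 1)) ]) ×
     r ≡ length (expand η (drop (length rev ∸ p) rev)))

-- Since u = η^p(u), every letter u_q of u is expanded into a block η^p(u_q) of u, starting at
-- blockStart q.  An admissible sequence T from a seed letter x, of length divisible by p, is a path
-- down the derivation tree of η^|T|(x); that word occurs in u (from 0 for x = u₀, ending at -1 for
-- x = u₋₁), so T determines a position pos T of u carrying the letter that T reaches, and p further
-- steps D land at pos (T ++ D) = blockStart (pos T) + |expand D|.  Splitting the sequence of n into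
-- its first k - p and last p steps thus gives n = blockStart q + r, whence u_n = η^p(u_q)[r];
-- appending the tail of r to the sequence of q gives the representation of n, the leading-block
-- conditions being inherited from q, or, when q ∈ {0, -1}, forced by n ∉ {0, -1}.

module Submission where

open import Defs
open import Data.Nat as ℕ using (ℕ; zero; suc; _≤_; _*_; _∸_; s≤s; z≤n)
open import Data.Nat.Divisibility using (_∣_; divides)
import Data.Nat.Properties as ℕₚ
open import Data.Integer as ℤ using (ℤ; +_; -[1+_]; _⊖_; +≤+; -≤-)
import Data.Integer.Properties as ℤₚ
open import Data.Fin using (Fin)
open import Data.List using (List; []; _∷_; _++_; map; concat; concatMap; length; upTo; applyUpTo; take; drop; [_])
import Data.List.Properties as Listₚ
open import Data.Maybe using (just)
open import Data.Product using (∃; _×_; _,_; proj₁; proj₂)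
open import Data.Unit using (tt)
open import Data.Empty using (⊥-elim)
open import Data.Sum using (inj₁; inj₂)
open import Function using (_∘_)
open import Relation.Binary.PropositionalEquality
  using (_≡_; _≢_; refl; sym; trans; cong; cong₂; subst; subst₂; module ≡-Reasoning)

module _ {A : Set} where

  lookupM-++ˡ : ∀ (xs ys : List A) i {a} → lookupM xs i ≡ just a → lookupM (xs ++ ys) i ≡ just a
  lookupM-++ˡ (x ∷ xs) ys zero    e = e
  lookupM-++ˡ (x ∷ xs) ys (suc i) e = lookupM-++ˡ xs ys i e

  lookupM-++ʳ : ∀ (xs ys : List A) i → lookupM (xs ++ ys) (length xs ℕ.+ i) ≡ lookupM ys i
  lookupM-++ʳ []       ys i = refl
  lookupM-++ʳ (x ∷ xs) ys i = lookupM-++ʳ xs ys i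

  lookupM-++-length : ∀ (xs : List A) y ys → lookupM (xs ++ y ∷ ys) (length xs) ≡ just y
  lookupM-++-length []       y ys = refl
  lookupM-++-length (x ∷ xs) y ys = lookupM-++-length xs y ys

  applyUpTo-lookupM : ∀ (xs : List A) f → (∀ i a → lookupM xs i ≡ just a → f i ≡ a) →
    applyUpTo f (length xs) ≡ xs
  applyUpTo-lookupM []       f _  = refl
  applyUpTo-lookupM (x ∷ xs) f fx = cong₂ _∷_ (fx 0 x refl) (applyUpTo-lookupM xs (f ∘ suc) (fx ∘ suc))

  take-++ˡ : ∀ n (xs ys : List A) → n ≤ length xs → take n (xs ++ ys) ≡ take n xs
  take-++ˡ zero    xs       ys _         = refl
  take-++ˡ (suc n) (x ∷ xs) ys (s≤s n≤) = cong (x ∷_) (take-++ˡ n xs ys n≤)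

  length-take-∸ : ∀ p (xs : List A) → length (take (length xs ∸ p) xs) ≡ length xs ∸ p
  length-take-∸ p xs = trans (Listₚ.length-take (length xs ∸ p) xs) (ℕₚ.m≤n⇒m⊓n≡m (ℕₚ.m∸n≤m (length xs) p))

  length-drop-∸ : ∀ p (xs : List A) → p ≤ length xs → length (drop (length xs ∸ p) xs) ≡ p
  length-drop-∸ p xs p≤ = trans (Listₚ.length-drop (length xs ∸ p) xs) (ℕₚ.m∸[m∸n]≡n p≤)

  length-++-block : ∀ p j (T D : List A) → length T ≡ j * p → length D ≡ p →
    length (T ++ D) ≡ suc j * p
  length-++-block p j T D |T| |D| =
    trans (Listₚ.length-++ T) (trans (cong₂ ℕ._+_ |T| |D|) (ℕₚ.+-comm (j * p) p))

  p≤length : ∀ p j (T : List A) → length T ≡ suc j * p → p ≤ length T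
  p≤length p j T |T| = subst (p ≤_) (sym |T|) (ℕₚ.m≤m+n p (j * p))

  take-length : ∀ p (D : List A) → length D ≡ p → take p D ≡ D
  take-length p D |D| = Listₚ.take-all p D (ℕₚ.≤-reflexive |D|)

module _ {A : Set} (η : A → List A) where

  pow-++ : ∀ k xs ys → pow η k (xs ++ ys) ≡ pow η k xs ++ pow η k ys
  pow-++ zero    xs ys = refl
  pow-++ (suc k) xs ys =
    trans (cong (concatMap η) (pow-++ k xs ys)) (Listₚ.concatMap-++ η (pow η k xs) (pow η k ys))

  pow-+ : ∀ a b w → pow η (a ℕ.+ b) w ≡ pow η a (pow η b w)
  pow-+ zero    b w = refl
  pow-+ (suc a) b w = cong (concatMap η) (pow-+ a b w)

  pow-[] : ∀ k → pow η k [] ≡ []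
  pow-[] zero    = refl
  pow-[] (suc k) = cong (concatMap η) (pow-[] k)

  pow-sucʳ : ∀ k w → pow η (suc k) w ≡ pow η k (concatMap η w)
  pow-sucʳ zero    w = refl
  pow-sucʳ (suc k) w = cong (concatMap η) (pow-sucʳ k w)

  pow-suc-[_] : ∀ k x → pow η (suc k) [ x ] ≡ pow η k (η x)
  pow-suc-[_] k x = trans (pow-sucʳ k [ x ]) (cong (pow η k) (Listₚ.++-identityʳ (η x)))

  expand-++ : ∀ T D → expand η (T ++ D) ≡ pow η (length D) (expand η T) ++ expand η D
  expand-++ []             D = cong (_++ expand η D) (sym (pow-[] (length D)))
  expand-++ ((m , a) ∷ T) D = begin
      pow η (length (T ++ D)) m ++ expand η (T ++ D)
    ≡⟨ cong₂ _++_ (cong (λ k → pow η k m) |T++D|) (expand-++ T D) ⟩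
      pow η (length D ℕ.+ length T) m ++ (pow η (length D) (expand η T) ++ expand η D)
    ≡⟨ cong (_++ _) (pow-+ (length D) (length T) m) ⟩
      pow η (length D) (pow η (length T) m) ++ (pow η (length D) (expand η T) ++ expand η D)
    ≡⟨ Listₚ.++-assoc (pow η (length D) (pow η (length T) m)) _ _ ⟨
      (pow η (length D) (pow η (length T) m) ++ pow η (length D) (expand η T)) ++ expand η D
    ≡⟨ cong (_++ expand η D) (pow-++ (length D) (pow η (length T) m) (expand η T)) ⟨
      pow η (length D) (pow η (length T) m ++ expand η T) ++ expand η D ∎
    where
    open ≡-Reasoning
    |T++D| : length (T ++ D) ≡ length D ℕ.+ length T
    |T++D| = trans (Listₚ.length-++ T) (ℕₚ.+-comm (length T) (length D))

  expand≡[] : ∀ T → concat (map proj₁ T) ≡ [] → expand η T ≡ []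
  expand≡[] []             _ = refl
  expand≡[] ((m , a) ∷ T) e = cong₂ _++_
    (trans (cong (pow η (length T)) (Listₚ.++-conicalˡ m _ e)) (pow-[] (length T)))
    (expand≡[] T (Listₚ.++-conicalʳ m _ e))

  finalLetter : A → Seq A → A
  finalLetter x []             = x
  finalLetter x ((m , a) ∷ T) = finalLetter a T

  lastLetter-finalLetter : ∀ x e T → lastLetter (e ∷ T) ≡ [ finalLetter x (e ∷ T) ]
  lastLetter-finalLetter x (m , a) []       = refl
  lastLetter-finalLetter x (m , a) (e ∷ T) = lastLetter-finalLetter a e T

  Adm-++⁻ : ∀ x T D → Adm η x (T ++ D) → Adm η x T × Adm η (finalLetter x T) D
  Adm-++⁻ x []             D adm         = tt , adm
  Adm-++⁻ x ((m , a) ∷ T) D (pre , adm) with Adm-++⁻ a T D adm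
  ... | admT , admD = (pre , admT) , admD

  Adm-++⁺ : ∀ x T D → Adm η x T → Adm η (finalLetter x T) D → Adm η x (T ++ D)
  Adm-++⁺ x []             D _            admD = admD
  Adm-++⁺ x ((m , a) ∷ T) D (pre , admT) admD = pre , Adm-++⁺ a T D admT admD

  adm-pow-split : ∀ x T → Adm η x T →
    ∃ λ Z → expand η T ++ finalLetter x T ∷ Z ≡ pow η (length T) [ x ]
  adm-pow-split x []             _                = [] , refl
  adm-pow-split x ((m , a) ∷ T) ((z , maz≡ηx) , adm) with adm-pow-split a T adm
  ... | Z , split = Z ++ pow η L z , (begin
      (pow η L m ++ expand η T) ++ y ∷ Z ++ pow η L z
    ≡⟨ Listₚ.++-assoc (pow η L m) (expand η T) _ ⟩
      pow η L m ++ expand η T ++ (y ∷ Z) ++ pow η L z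
    ≡⟨ cong (pow η L m ++_) (Listₚ.++-assoc (expand η T) (y ∷ Z) _) ⟨
      pow η L m ++ (expand η T ++ y ∷ Z) ++ pow η L z
    ≡⟨ cong (λ w → pow η L m ++ w ++ pow η L z) split ⟩
      pow η L m ++ pow η L [ a ] ++ pow η L z
    ≡⟨ cong (pow η L m ++_) (pow-++ L [ a ] z) ⟨
      pow η L m ++ pow η L (a ∷ z)
    ≡⟨ pow-++ L m (a ∷ z) ⟨
      pow η L (m ++ a ∷ z)
    ≡⟨ cong (pow η L) (trans (sym (Listₚ.++-assoc m [ a ] z)) maz≡ηx) ⟩
      pow η L (η x)
    ≡⟨ pow-suc-[ L ] x ⟨
      pow η (suc L) [ x ] ∎)
    where
    open ≡-Reasoning
    L = length T
    y = finalLetter a T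

  lookupM-expand : ∀ x T → Adm η x T → lookupM (pow η (length T) [ x ]) (length (expand η T)) ≡ just (finalLetter x T)
  lookupM-expand x T adm with adm-pow-split x T adm
  ... | Z , split = subst (λ w → lookupM w (length (expand η T)) ≡ just (finalLetter x T)) split
                          (lookupM-++-length (expand η T) (finalLetter x T) Z)

module _ {A : Set} (u : ℤ → A) where

  Occurs : ℤ → List A → Set
  Occurs s xs = ∀ i a → lookupM xs i ≡ just a → u (s ℤ.+ + i) ≡ a

  Occurs-++⁻ˡ : ∀ s xs ys → Occurs s (xs ++ ys) → Occurs s xs
  Occurs-++⁻ˡ s xs ys occ i a e = occ i a (lookupM-++ˡ xs ys i e)

  Occurs-++⁻ʳ : ∀ s xs ys → Occurs s (xs ++ ys) → Occurs (s ℤ.+ + length xs) ys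
  Occurs-++⁻ʳ s xs ys occ i a e =
    trans (cong u (ℤₚ.+-assoc s (+ length xs) (+ i))) (occ (length xs ℕ.+ i) a (trans (lookupM-++ʳ xs ys i) e))

  Occurs-head : ∀ {s y} ys → Occurs s (y ∷ ys) → u s ≡ y
  Occurs-head {s} ys occ = trans (cong u (sym (ℤₚ.+-identityʳ s))) (occ 0 _ refl)

  Occurs⇒segment : ∀ s xs → Occurs s xs → segment u s (length xs) ≡ xs
  Occurs⇒segment s xs occ =
    trans (Listₚ.map-upTo (λ i → u (s ℤ.+ + i)) (length xs)) (applyUpTo-lookupM xs _ occ)

  segment-∷ʳ : ∀ s i → segment u s (suc i) ≡ segment u s i ++ [ u (s ℤ.+ + i) ]
  segment-∷ʳ s i = trans (cong (map (λ j → u (s ℤ.+ + j))) (sym (Listₚ.upTo-∷ʳ i)))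
                         (Listₚ.map-++ (λ j → u (s ℤ.+ + j)) (upTo i) [ i ])

-[m+n]+[m+o]≡-n+o : ∀ m n o → ℤ.- (+ (m ℕ.+ n)) ℤ.+ + (m ℕ.+ o) ≡ ℤ.- (+ n) ℤ.+ + o
-[m+n]+[m+o]≡-n+o m n o = begin
    ℤ.- (+ (m ℕ.+ n)) ℤ.+ + (m ℕ.+ o) ≡⟨ ℤₚ.-m+n≡n⊖m (m ℕ.+ n) (m ℕ.+ o) ⟩
    (m ℕ.+ o) ⊖ (m ℕ.+ n)             ≡⟨ ℤₚ.+-cancelˡ-⊖ m o n ⟩
    o ⊖ n                             ≡⟨ ℤₚ.-m+n≡n⊖m n o ⟨
    ℤ.- (+ n) ℤ.+ + o                 ∎
  where open ≡-Reasoning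

+≢0⇒+1≤ : ∀ {n k} → n ≡ + k → n ≢ + 0 → ℤ.+ 1 ℤ.≤ n
+≢0⇒+1≤ {k = zero}  refl n≢0 = ⊥-elim (n≢0 refl)
+≢0⇒+1≤ {k = suc k} refl _   = +≤+ (s≤s z≤n)

-[1+]≢-1⇒≤-2 : ∀ {n k} → n ≡ -[1+ k ] → n ≢ ℤ.- (+ 1) → n ℤ.≤ ℤ.- (+ 2)
-[1+]≢-1⇒≤-2 {k = zero}  refl n≢-1 = ⊥-elim (n≢-1 refl)
-[1+]≢-1⇒≤-2 {k = suc k} refl _    = -≤- (s≤s z≤n)

module PeriodicPoint {A : Set} (η : A → List A) (u : ℤ → A) (p : ℕ) (fixed : IsImage η p u u) where

  x₀ x₁ : A
  x₀ = u (+ 0)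
  x₁ = u (ℤ.- (+ 1))

  occurs-image₀ : ∀ W → Occurs u (+ 0) W → Occurs u (+ 0) (pow η p W)
  occurs-image₀ W occ =
    subst (λ V → Occurs u (+ 0) (pow η p V)) (Occurs⇒segment u (+ 0) W occ) (proj₁ fixed (length W))

  occurs-image₁ : ∀ W → Occurs u (ℤ.- (+ length W)) W → Occurs u (ℤ.- (+ length (pow η p W))) (pow η p W)
  occurs-image₁ W occ =
    subst (λ V → Occurs u (ℤ.- (+ length (pow η p V))) (pow η p V)) (Occurs⇒segment u (ℤ.- (+ length W)) W occ)
          (proj₂ fixed (length W))

  occurs-pow₀ : ∀ {k} → p ∣ k → Occurs u (+ 0) (pow η k [ x₀ ])
  occurs-pow₀ (divides zero    refl) zero a refl = refl
  occurs-pow₀ (divides (suc j) refl) =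
    subst (Occurs u (+ 0)) (sym (pow-+ η p (j * p) [ x₀ ]))
          (occurs-image₀ (pow η (j * p) [ x₀ ]) (occurs-pow₀ (divides j refl)))

  occurs-pow₁ : ∀ {k} → p ∣ k → Occurs u (ℤ.- (+ length (pow η k [ x₁ ]))) (pow η k [ x₁ ])
  occurs-pow₁ (divides zero    refl) zero a refl = refl
  occurs-pow₁ (divides (suc j) refl) =
    subst (λ V → Occurs u (ℤ.- (+ length V)) V) (sym (pow-+ η p (j * p) [ x₁ ]))
          (occurs-image₁ (pow η (j * p) [ x₁ ]) (occurs-pow₁ (divides j refl)))

  blockStart : ℤ → ℤ
  blockStart (+ i)    = + length (pow η p (segment u (+ 0) i))
  blockStart -[1+ k ] = ℤ.- (+ length (pow η p (segment u -[1+ k ] (suc k))))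

  occurs-blockStart : ∀ q → Occurs u (blockStart q) (pow η p [ u q ])
  occurs-blockStart (+ i) = Occurs-++⁻ʳ u (+ 0) (pow η p S) (pow η p [ u (+ i) ])
    (subst (Occurs u (+ 0)) (trans (cong (pow η p) (segment-∷ʳ u (+ 0) i)) (pow-++ η p S [ u (+ i) ]))
           (proj₁ fixed (suc i)))
    where S = segment u (+ 0) i
  occurs-blockStart -[1+ k ] =
    subst (λ a → Occurs u (blockStart -[1+ k ]) (pow η p [ a ])) (cong u (ℤₚ.+-identityʳ -[1+ k ]))
      (Occurs-++⁻ˡ u (blockStart -[1+ k ]) (pow η p [ h ]) (pow η p rest)
        (subst (Occurs u (blockStart -[1+ k ])) (pow-++ η p [ h ] rest) (proj₂ fixed (suc k))))
    where
    h    = u (-[1+ k ] ℤ.+ + 0)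
    rest = map (λ i → u (-[1+ k ] ℤ.+ + i)) (applyUpTo suc k)

  pos₀ : Seq A → ℤ
  pos₀ T = + length (expand η T)

  occurs-expand₀ : ∀ T → p ∣ length T → Adm η x₀ T →
    ∃ λ Z → Occurs u (+ 0) (expand η T ++ finalLetter η x₀ T ∷ Z)
  occurs-expand₀ T p∣ adm with adm-pow-split η x₀ T adm
  ... | Z , split = Z , subst (Occurs u (+ 0)) (sym split) (occurs-pow₀ p∣)

  u-pos₀ : ∀ T → p ∣ length T → Adm η x₀ T → u (pos₀ T) ≡ finalLetter η x₀ T
  u-pos₀ T p∣ adm with occurs-expand₀ T p∣ adm
  ... | Z , occ = Occurs-head u Z (Occurs-++⁻ʳ u (+ 0) (expand η T) _ occ)

  segment-pos₀ : ∀ T → p ∣ length T → Adm η x₀ T → segment u (+ 0) (length (expand η T)) ≡ expand η T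
  segment-pos₀ T p∣ adm with occurs-expand₀ T p∣ adm
  ... | Z , occ = Occurs⇒segment u (+ 0) (expand η T) (Occurs-++⁻ˡ u (+ 0) (expand η T) _ occ)

  pos₀-++ : ∀ T D → p ∣ length T → Adm η x₀ T → length D ≡ p →
    pos₀ (T ++ D) ≡ blockStart (pos₀ T) ℤ.+ + length (expand η D)
  pos₀-++ T D p∣ adm |D| = cong +_ (begin
      length (expand η (T ++ D))
    ≡⟨ cong length (expand-++ η T D) ⟩
      length (pow η (length D) (expand η T) ++ expand η D)
    ≡⟨ Listₚ.length-++ (pow η (length D) (expand η T)) ⟩
      length (pow η (length D) (expand η T)) ℕ.+ length (expand η D)
    ≡⟨ cong (λ w → length w ℕ.+ length (expand η D)) (cong₂ (pow η) |D| (sym (segment-pos₀ T p∣ adm))) ⟩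
      length (pow η p (segment u (+ 0) (length (expand η T)))) ℕ.+ length (expand η D) ∎)
    where open ≡-Reasoning

  start₁ : Seq A → ℤ
  start₁ T = ℤ.- (+ length (pow η (length T) [ x₁ ]))

  pos₁ : Seq A → ℤ
  pos₁ T = start₁ T ℤ.+ + length (expand η T)

  pos₁-split : ∀ T y Z → expand η T ++ y ∷ Z ≡ pow η (length T) [ x₁ ] → pos₁ T ≡ -[1+ length Z ]
  pos₁-split T y Z split = begin
      ℤ.- (+ length (pow η (length T) [ x₁ ])) ℤ.+ + length E
    ≡⟨ cong₂ (λ a b → ℤ.- (+ a) ℤ.+ + b) (trans (cong length (sym split)) (Listₚ.length-++ E))
                                          (sym (ℕₚ.+-identityʳ (length E))) ⟩
      ℤ.- (+ (length E ℕ.+ suc (length Z))) ℤ.+ + (length E ℕ.+ 0)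
    ≡⟨ -[m+n]+[m+o]≡-n+o (length E) (suc (length Z)) 0 ⟩
      -[1+ length Z ] ∎
    where
    open ≡-Reasoning
    E = expand η T

  occurs-expand₁ : ∀ T → p ∣ length T → Adm η x₁ T →
    ∃ λ Z → expand η T ++ finalLetter η x₁ T ∷ Z ≡ pow η (length T) [ x₁ ] ×
            Occurs u (start₁ T) (expand η T ++ finalLetter η x₁ T ∷ Z)
  occurs-expand₁ T p∣ adm with adm-pow-split η x₁ T adm
  ... | Z , split = Z , split , subst (Occurs u (start₁ T)) (sym split) (occurs-pow₁ p∣)

  u-pos₁ : ∀ T → p ∣ length T → Adm η x₁ T → u (pos₁ T) ≡ finalLetter η x₁ T
  u-pos₁ T p∣ adm with occurs-expand₁ T p∣ adm
  ... | Z , _ , occ = Occurs-head u Z (Occurs-++⁻ʳ u (start₁ T) (expand η T) _ occ)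

  segment-pos₁ : ∀ T → p ∣ length T → Adm η x₁ T →
    segment u (start₁ T) (length (expand η T)) ≡ expand η T
  segment-pos₁ T p∣ adm with occurs-expand₁ T p∣ adm
  ... | Z , _ , occ = Occurs⇒segment u (start₁ T) (expand η T) (Occurs-++⁻ˡ u (start₁ T) (expand η T) _ occ)

  pos₁-++ : ∀ T D → p ∣ length T → Adm η x₁ T → length D ≡ p →
    pos₁ (T ++ D) ≡ blockStart (pos₁ T) ℤ.+ + length (expand η D)
  pos₁-++ T D p∣ adm |D| with occurs-expand₁ T p∣ adm
  ... | Z , split , occ = begin
      pos₁ (T ++ D)
    ≡⟨ cong₂ (λ a b → ℤ.- (+ a) ℤ.+ + b) |W′| |E′| ⟩
      ℤ.- (+ (a ℕ.+ b)) ℤ.+ + (a ℕ.+ c)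
    ≡⟨ -[m+n]+[m+o]≡-n+o a b c ⟩
      ℤ.- (+ b) ℤ.+ + c
    ≡⟨ cong (ℤ._+ + c) start ⟨
      blockStart (pos₁ T) ℤ.+ + c ∎
    where
    open ≡-Reasoning
    E = expand η T
    y = finalLetter η x₁ T
    a = length (pow η p E)
    b = length (pow η p (y ∷ Z))
    c = length (expand η D)
    start : blockStart (pos₁ T) ≡ ℤ.- (+ b)
    start = trans (cong blockStart (pos₁-split T y Z split))
                  (cong (λ w → ℤ.- (+ length (pow η p w))) (Occurs⇒segment u -[1+ length Z ] (y ∷ Z)
                    (subst (λ s → Occurs u s (y ∷ Z)) (pos₁-split T y Z split) (Occurs-++⁻ʳ u (start₁ T) E (y ∷ Z) occ))))
    |E′| : length (expand η (T ++ D)) ≡ a ℕ.+ c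
    |E′| = trans (cong length (expand-++ η T D))
                 (trans (Listₚ.length-++ (pow η (length D) E)) (cong (λ k → length (pow η k E) ℕ.+ c) |D|))
    |W′| : length (pow η (length (T ++ D)) [ x₁ ]) ≡ a ℕ.+ b
    |W′| = begin
        length (pow η (length (T ++ D)) [ x₁ ])
      ≡⟨ cong (λ k → length (pow η k [ x₁ ]))
              (trans (Listₚ.length-++ T) (trans (ℕₚ.+-comm (length T) _) (cong (ℕ._+ length T) |D|))) ⟩
        length (pow η (p ℕ.+ length T) [ x₁ ])
      ≡⟨ cong length (trans (pow-+ η p (length T) [ x₁ ]) (cong (pow η p) (sym split))) ⟩
        length (pow η p (E ++ y ∷ Z))
      ≡⟨ cong length (pow-++ η p E (y ∷ Z)) ⟩
        length (pow η p E ++ pow η p (y ∷ Z))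
      ≡⟨ Listₚ.length-++ (pow η p E) ⟩
        a ℕ.+ b ∎

  pos₁-lastBlock : ∀ D → expand η D ++ lastLetter D ≡ pow η (length D) [ x₁ ] → pos₁ D ≡ ℤ.- (+ 1)
  pos₁-lastBlock []      ()
  pos₁-lastBlock (e ∷ D) whole = pos₁-split (e ∷ D) (finalLetter η x₁ (e ∷ D)) []
    (trans (cong (expand η (e ∷ D) ++_) (sym (lastLetter-finalLetter η x₁ e D))) whole)

  posData-++ : ∀ {n} j T D → length T ≡ j * p → Adm η x₀ T → length D ≡ p → Adm η (u (pos₀ T)) D →
    concat (map proj₁ (take p (T ++ D))) ≢ [] → n ≢ + 0 →
    n ≡ blockStart (pos₀ T) ℤ.+ + length (expand η D) → PosData η u p n (T ++ D)
  posData-++ j T D |T| admT |D| admD leading n≢0 n≡ =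
    +≢0⇒+1≤ n≡pos n≢0 , (j , |T++D|) , adm , leading , n≡pos , segment-pos₀ (T ++ D) (divides (suc j) |T++D|) adm
    where
    |T++D| = length-++-block p j T D |T| |D|
    adm = Adm-++⁺ η x₀ T D admT (subst (λ a → Adm η a D) (u-pos₀ T (divides j |T|) admT) admD)
    n≡pos = trans n≡ (sym (pos₀-++ T D (divides j |T|) admT |D|))

  negData-++ : ∀ {n} j T D → length T ≡ j * p → Adm η x₁ T → length D ≡ p → Adm η (u (pos₁ T)) D →
    expand η (take p (T ++ D)) ++ lastLetter (take p (T ++ D)) ≢ pow η p [ x₁ ] → n ≢ ℤ.- (+ 1) →
    n ≡ blockStart (pos₁ T) ℤ.+ + length (expand η D) → NegData η u p n (T ++ D)
  negData-++ j T D |T| admT |D| admD notLast n≢-1 n≡ =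
    -[1+]≢-1⇒≤-2 n≡-[1+] n≢-1 , (j , |T++D|) , adm , notLast , n≡pos , segment-pos₁ (T ++ D) (divides (suc j) |T++D|) adm
    where
    |T++D| = length-++-block p j T D |T| |D|
    adm = Adm-++⁺ η x₁ T D admT (subst (λ a → Adm η a D) (u-pos₁ T (divides j |T|) admT) admD)
    n≡pos = trans n≡ (sym (pos₁-++ T D (divides j |T|) admT |D|))
    n≡-[1+] = trans n≡pos (pos₁-split (T ++ D) _ _ (proj₂ (adm-pow-split η x₁ (T ++ D) adm)))

  rep-++ : ∀ {n q w} D → IsRep η u p q w → length D ≡ p → Adm η (u q) D →
    n ≡ blockStart q ℤ.+ + length (expand η D) → n ≢ ℤ.- (+ 1) → n ≢ + 0 →
    IsRep η u p n (w ++ digits D)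
  rep-++ D rep0 |D| admD n≡ _ n≢0 = repPos _ D (posData-++ 0 [] D refl tt |D| admD leading n≢0 n≡)
    where
    leading : concat (map proj₁ (take p D)) ≢ []
    leading silent = n≢0 (begin
        _                                          ≡⟨ n≡ ⟩
        blockStart (+ 0) ℤ.+ + length (expand η D) ≡⟨ pos₀-++ [] D (divides 0 refl) tt |D| ⟨
        + length (expand η D)                      ≡⟨ cong (+_ ∘ length) (expand≡[] η D
                                                        (subst (λ T → concat (map proj₁ T) ≡ []) (take-length p D |D|) silent)) ⟩
        + 0                                        ∎)
      where open ≡-Reasoning
  rep-++ D rep-1 |D| admD n≡ n≢-1 _ = repNeg _ D (negData-++ 0 [] D refl tt |D| admD notLast n≢-1 n≡)
    where
    notLast : expand η (take p D) ++ lastLetter (take p D) ≢ pow η p [ x₁ ]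
    notLast whole = n≢-1 (trans n≡ (trans (sym (pos₁-++ [] D (divides 0 refl) tt |D|))
      (pos₁-lastBlock D (subst₂ (λ T k → expand η T ++ lastLetter T ≡ pow η k [ x₁ ])
                                (take-length p D |D|) (sym |D|) whole))))
  rep-++ D (repPos _ T (_ , (j , |T|) , admT , leading , refl , _)) |D| admD n≡ _ n≢0 =
    subst (λ ds → IsRep η u p _ (0 ∷ ds)) (Listₚ.map-++ _ T D)
      (repPos _ (T ++ D) (posData-++ (suc j) T D |T| admT |D| admD
        (subst (λ S → concat (map proj₁ S) ≢ []) (sym (take-++ˡ p T D (p≤length p j T |T|))) leading) n≢0 n≡))
  rep-++ D (repNeg _ T (_ , (j , |T|) , admT , notLast , refl , _)) |D| admD n≡ n≢-1 _ =
    subst (λ ds → IsRep η u p _ (1 ∷ ds)) (Listₚ.map-++ _ T D)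
      (repNeg _ (T ++ D) (negData-++ (suc j) T D |T| admT |D| admD
        (subst (λ S → expand η S ++ lastLetter S ≢ pow η p [ x₁ ]) (sym (take-++ˡ p T D (p≤length p j T |T|))) notLast)
        n≢-1 n≡))

  QuotientBlock : ℤ → ℤ → ℕ → Set
  QuotientBlock n q r =
    n ≡ blockStart q ℤ.+ + r × ∃ λ D → length D ≡ p × Adm η (u q) D × r ≡ length (expand η D)

  seqData⇒block : ∀ {x n q r} (pos : Seq A → ℤ) →
    (∀ T → p ∣ length T → Adm η x T → u (pos T) ≡ finalLetter η x T) →
    (∀ T D → p ∣ length T → Adm η x T → length D ≡ p →
       pos (T ++ D) ≡ blockStart (pos T) ℤ.+ + length (expand η D)) →
    ∀ j rev → length rev ≡ suc j * p → Adm η x rev → n ≡ pos rev →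
    q ≡ pos (take (length rev ∸ p) rev) → r ≡ length (expand η (drop (length rev ∸ p) rev)) →
    QuotientBlock n q r
  seqData⇒block {x} pos u-pos pos-++ j rev |rev| adm n≡ refl refl =
    trans n≡ (trans (cong pos (sym split)) (pos-++ T D p∣T admT |D|)) ,
    D , |D| , subst (λ a → Adm η a D) (sym (u-pos T p∣T admT)) admD , refl
    where
    K = length rev ∸ p
    T = take K rev
    D = drop K rev
    split = Listₚ.take++drop≡id K rev
    p∣T : p ∣ length T
    p∣T = divides j (trans (length-take-∸ p rev) (trans (cong (_∸ p) |rev|) (ℕₚ.m+n∸m≡n p (j * p))))
    |D| : length D ≡ p
    |D| = length-drop-∸ p rev (p≤length p j rev |rev|)
    admT = proj₁ (Adm-++⁻ η x T D (subst (Adm η x) (sym split) adm))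
    admD = proj₂ (Adm-++⁻ η x T D (subst (Adm η x) (sym split) adm))

  quotRem⇒block : ∀ {n q r} → IsQuotRem η u p n q r → QuotientBlock n q r
  quotRem⇒block (rev , inj₁ ((_ , (j , |rev|) , adm , _ , n≡ , _) , q≡ , r≡)) =
    seqData⇒block pos₀ u-pos₀ pos₀-++ j rev |rev| adm n≡ q≡ r≡
  quotRem⇒block (rev , inj₂ ((_ , (j , |rev|) , adm , _ , n≡ , _) , q≡ , r≡)) =
    seqData⇒block pos₁ u-pos₁ pos₁-++ j rev |rev| adm n≡ q≡pos r≡
    where
    T = take (length rev ∸ p) rev
    q≡pos = trans q≡ (trans (ℤₚ.+-comm (+ length (expand η T)) (ℤ.- (+ length (pow η (length rev ∸ p) [ x₁ ]))))
                            (cong (λ k → ℤ.- (+ length (pow η k [ x₁ ])) ℤ.+ + length (expand η T))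
                                  (sym (length-take-∸ p rev))))

  block-lookupM : ∀ {n q r} → QuotientBlock n q r → lookupM (pow η p [ u q ]) r ≡ just (u n)
  block-lookupM {n} {q} (n≡ , D , |D| , admD , refl) =
    trans lookup-D (cong just (sym (trans (cong u n≡) (occurs-blockStart q _ _ lookup-D))))
    where
    lookup-D : lookupM (pow η p [ u q ]) (length (expand η D)) ≡ just (finalLetter η (u q) D)
    lookup-D = subst (λ k → lookupM (pow η k [ u q ]) _ ≡ _) |D| (lookupM-expand η (u q) D admD)


lemma15 : (s : ℕ) (η : Fin s → List (Fin s)) → IsSubstitution η →
    (u : ℤ → Fin s) (p : ℕ) → IsPeriodicPoint η u p → GrowingSeed η u →
    (n q : ℤ) (r : ℕ) → n ≢ ℤ.- (+ 1) → n ≢ + 0 → IsQuotRem η u p n q r →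
    (lookupM (pow η p [ u q ]) r ≡ just (u n)) ×
    (∀ w t → IsRep η u p q w → IsTail η p (u q) r t → IsRep η u p n (w ++ t))
-- Non-erasure, growth, 1 ≤ p and minimality of p are only needed for the representations to
-- exist; here they are hypotheses.
lemma15 s η _ u p (_ , fixed , _) _ n q r n≢-1 n≢0 qr =
  block-lookupM block , λ w t rep (_ , D , |D| , admD , |E| , t≡) →
    subst (λ t → IsRep η u p n (w ++ t)) (sym t≡)
      (rep-++ D rep |D| admD (trans (proj₁ block) (cong (λ k → blockStart q ℤ.+ + k) (sym |E|))) n≢-1 n≢0)
  where
  open PeriodicPoint η u p fixed
  block = quotRem⇒block qr
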